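{- For every $n$, $\mathcal M_{n-2,2}=0$; that is, every class $[\mathsf M,\eta]$ with $\mathsf M$ of rank $2$ vanishes.
   Context: An orientation of a matroid $\mathsf M$ is a generator $\eta$ of $\bigwedge^{|E|}\mathbb{Z}\langle E\rangle$, $E=E(\mathsf M)$. $\mathcal M$ is the $\mathbb{Q}$-vector space spanned by symbols $[\mathsf M,\eta]$ modulo $[\mathsf M,-\eta]=-[\mathsf M,\eta]$ and $[\mathsf M,\eta]=[\mathsf M',\psi_*\eta]$ for every matroid isomorphism $\psi:\mathsf M\to\mathsf M'$ ($\psi_*$ the induced map on top exterior powers); $\mathcal M_{k,r}$ is the span of classes with nullity $k=|E(\mathsf M)|-\mathrm{rk}(\mathsf M)$ and rank $r$. -}

module Defs where

open import Level using (Level; _⊔_; Setω; 0ℓ) renaming (suc to lsuc)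
open import Data.Bool using (Bool; true; false; T)
open import Data.Nat using (ℕ; zero; suc; _<_; _≤_; _+_)
open import Data.Fin using (Fin; toℕ)
open import Data.Fin.Subset using (Subset; ∣_∣; ⊥; _⊆_; _∈_; _∉_; _∪_; ⁅_⁆)
open import Data.Fin.Permutation using (Permutation′; _⟨$⟩ʳ_; _⟨$⟩ˡ_)
open import Data.Vec using (Vec; tabulate; lookup)
open import Data.List using (List; allFin; map; concatMap)
open import Data.Nat.ListAction using (sum)
open import Data.Sign using (Sign) renaming (_*_ to _*ˢ_; + to s+; - to s-)
open import Data.Product using (Σ; _×_; ∃; ∃-syntax; _,_)
open import Relation.Binary.PropositionalEquality using (_≡_)
open import Relation.Nullary using (¬_)
open import Data.Rational.Properties using (+-*-commutativeRing)
open import Algebra.Module.Bundles using (Module)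
open import Algebra.Bundles using (CommutativeRing)

Indep : ∀ {n} → (Subset n → Bool) → Subset n → Set
Indep ind S = T (ind S)

record IsMatroid (n : ℕ) (ind : Subset n → Bool) : Set where
  field
    empty-indep : Indep ind ⊥
    hereditary  : ∀ {I J} → I ⊆ J → Indep ind J → Indep ind I
    augment     : ∀ {I J} → Indep ind I → Indep ind J → ∣ I ∣ < ∣ J ∣ →
                  ∃[ x ] (x ∈ J × x ∉ I × Indep ind (I ∪ ⁅ x ⁆))

HasRank : ∀ {n} → (Subset n → Bool) → ℕ → Set
HasRank ind r = (∃[ B ] (Indep ind B × ∣ B ∣ ≡ r)) × (∀ S → Indep ind S → ∣ S ∣ ≤ r)

image : ∀ {n} → Permutation′ n → Subset n → Subset n
image ψ S = tabulate (λ j → lookup S (ψ ⟨$⟩ˡ j))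

IsIso : ∀ {n} → (Subset n → Bool) → (Subset n → Bool) → Permutation′ n → Set
IsIso ind ind' ψ = ∀ S → ind' (image ψ S) ≡ ind S

isInv : ∀ {n} → Permutation′ n → Fin n → Fin n → ℕ
isInv ψ i j with toℕ i Data.Nat.<ᵇ toℕ j | toℕ (ψ ⟨$⟩ʳ j) Data.Nat.<ᵇ toℕ (ψ ⟨$⟩ʳ i)
... | true | true = 1
... | _    | _    = 0

inversions : ∀ {n} → Permutation′ n → ℕ
inversions {n} ψ = sum (concatMap (λ i → map (λ j → isInv ψ i j) (allFin n)) (allFin n))

parity : ℕ → Sign
parity zero = s+
parity (suc zero) = s-
parity (suc (suc k)) = parity k

sign : ∀ {n} → Permutation′ n → Sign
sign ψ = parity (inversions ψ)

-- An orientation of a matroid on E = Fin n is a generator of the top exterior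
-- power of ℤ⟨Fin n⟩, i.e.  ε · e₀ ∧ … ∧ e_{n-1}  with ε = ±1; we record ε.
Orientation : ℕ → Set
Orientation n = Sign

-- ψ_* (ε e₀ ∧ … ∧ e_{n-1}) = ε e_{ψ0} ∧ … ∧ e_{ψ(n-1)} = ε sign(ψ) e₀ ∧ … ∧ e_{n-1}
push : ∀ {n} → Permutation′ n → Orientation n → Orientation n
push ψ η = sign ψ *ˢ η

negate : ∀ {n} → Orientation n → Orientation n
negate η = s- *ˢ η

ℚ-ring : CommutativeRing 0ℓ 0ℓ
ℚ-ring = +-*-commutativeRing

-- A "symbol assignment": f sends each symbol [M, η] to a vector of V and
-- satisfies the defining relations of 𝓜.  The space 𝓜 is the universal
-- (initial) such ℚ-vector space; a class [M,η] vanishes in 𝓜 iff its image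
-- is 0 under every such assignment.
record Respects {c ℓ} (V : Module ℚ-ring c ℓ)
  (f : (n : ℕ) → (Subset n → Bool) → Orientation n → Module.Carrierᴹ V) : Set (c ⊔ ℓ) where
  open Module V
  field
    sign-rel : ∀ n ind → IsMatroid n ind → ∀ η →
               f n ind (negate {n} η) ≈ᴹ (-ᴹ f n ind η)
    iso-rel  : ∀ n ind ind' → IsMatroid n ind → IsMatroid n ind' →
               ∀ (ψ : Permutation′ n) → IsIso ind ind' ψ → ∀ η →
               f n ind η ≈ᴹ f n ind' (push ψ η)

ClassVanishes : (n : ℕ) → (Subset n → Bool) → Orientation n → Setω
ClassVanishes n ind η =
  ∀ {c ℓ} (V : Module ℚ-ring c ℓ) f → Respects V f → Module._≈ᴹ_ V (f n ind η) (Module.0ᴹ V)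

{-# OPTIONS --safe #-}

-- A matroid of rank 2 has two distinct elements i, j whose transposition is an automorphism:
-- a parallel pair if there is one, and otherwise any two non-loops, since without parallel
-- pairs a set is independent exactly when it consists of at most two non-loops.  Relabelling
-- i, j as 0, 1 turns this automorphism into the transposition (0 1), which has exactly one
-- inversion, so the relations of 𝓜 give [M, η] = [M, sign (0 1) · η] = [M, −η] = −[M, η].
-- Hence 2 [M, η] = 0, and [M, η] = 0 since 2 is invertible in ℚ.

module Submission where

open import Defs
open import Algebra.Module.Bundles using (Module)
import Algebra.Properties.CommutativeMonoid.Sum as CommutativeMonoidSum
open import Data.Bool using (Bool; true; false; T; T?; if_then_else_)
open import Data.Empty using (⊥-elim)
open import Data.Fin using (Fin; suc; toℕ; _≟_)
open import Data.Fin.Patterns using (0F; 1F)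
open import Data.Fin.Permutation
  using (Permutation′; _⟨$⟩ʳ_; _⟨$⟩ˡ_; _≈_; _∘ₚ_; id; flip; inverseˡ; inverseʳ; transpose)
import Data.Fin.Permutation.Components as PC
open import Data.Fin.Properties using (any?)
open import Data.Fin.Subset using (Subset; ∣_∣; _⊆_; _∈_; _∉_; _∪_; ⁅_⁆)
open import Data.Fin.Subset.Properties
  using (_∈?_; nonempty?; Empty-unique; ∉⊥; ∪-comm; x∈p∪q⁻; x∈p∪q⁺; x∈⁅x⁆; x∈⁅y⁆⇒x≡y; x≢y⇒x∉⁅y⁆;
         ∣⁅x⁆∣≡1; ∣⊥∣≡0; p⊆p∪q; q⊆p∪q; p⊆q⇒∣p∣≤∣q∣; p⊂q⇒∣p∣<∣q∣)
open import Data.List using (List; map; concatMap; allFin; tabulate)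
open import Data.List.Relation.Unary.All using (All; []; _∷_)
open import Data.List.Relation.Unary.All.Properties using (map⁺; ++⁺; concat⁺; tabulate⁺)
open import Data.Nat using (ℕ; zero; suc; _<_; _≤_; _<ᵇ_)
open import Data.Nat.ListAction using (sum)
open import Data.Nat.Properties
  using (<ᵇ⇒<; <-asym; <⇒≱; ≤-refl; +-0-commutativeMonoid; module ≤-Reasoning)
open import Data.Product using (_×_; _,_; proj₁; ∃-syntax)
open import Data.Rational using (½; 1ℚ; _*_) renaming (_+_ to _+ℚ_)
open import Data.Sign using () renaming (_*_ to _*ˢ_; - to s-)
open import Data.Sum using (_⊎_; inj₁; inj₂; [_,_])
import Data.Sum as Sum
open import Data.Vec using (lookup) renaming (tabulate to tabulateᵛ)
open import Data.Vec.Properties using (lookup∘tabulate; tabulate∘lookup; tabulate-cong; []=⇒lookup; lookup⇒[]=)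
open import Function using (_∘_)
open import Function.Bundles using (Injection)
open import Function.Properties.Inverse using (Inverse⇒Injection)
open import Relation.Binary.PropositionalEquality
  using (_≡_; _≢_; refl; sym; trans; cong; cong₂; subst; subst₂; module ≡-Reasoning)
open import Relation.Nullary using (¬_; Dec; yes; no; ¬?; _×-dec_)
open import Relation.Nullary.Decidable using (dec-true; dec-false; decidable-stable)
import Relation.Binary.Reasoning.Setoid as ≈-Reasoning

open CommutativeMonoidSum +-0-commutativeMonoid using (sum-permute) renaming (sum to ∑)

permutation-injective : ∀ {n} (ψ : Permutation′ n) {x y} → ψ ⟨$⟩ʳ x ≡ ψ ⟨$⟩ʳ y → x ≡ y
permutation-injective ψ = Injection.injective (Inverse⇒Injection ψ)

module _ {n : ℕ} where

  x∈p⇒⁅x⁆⊆p : ∀ {x : Fin n} {p} → x ∈ p → ⁅ x ⁆ ⊆ p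
  x∈p⇒⁅x⁆⊆p {p = p} x∈p y∈⁅x⁆ = subst (_∈ p) (sym (x∈⁅y⁆⇒x≡y _ y∈⁅x⁆)) x∈p

  ∪-lub : ∀ {p q r : Subset n} → p ⊆ r → q ⊆ r → p ∪ q ⊆ r
  ∪-lub {p} {q} p⊆r q⊆r x∈p∪q = [ p⊆r , q⊆r ] (x∈p∪q⁻ p q x∈p∪q)

  ∈-pair⁺ : ∀ {x a b : Fin n} → x ≡ a ⊎ x ≡ b → x ∈ ⁅ a ⁆ ∪ ⁅ b ⁆
  ∈-pair⁺ {a = a} (inj₁ refl) = x∈p∪q⁺ (inj₁ (x∈⁅x⁆ a))
  ∈-pair⁺ {b = b} (inj₂ refl) = x∈p∪q⁺ (inj₂ (x∈⁅x⁆ b))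

  ∈-pair⁻ : ∀ {x a b : Fin n} → x ∈ ⁅ a ⁆ ∪ ⁅ b ⁆ → x ≡ a ⊎ x ≡ b
  ∈-pair⁻ {a = a} {b} x∈ab = Sum.map (x∈⁅y⁆⇒x≡y a) (x∈⁅y⁆⇒x≡y b) (x∈p∪q⁻ ⁅ a ⁆ ⁅ b ⁆ x∈ab)

  ∣p∣<∣p∪⁅x⁆∣ : ∀ {p : Subset n} {x} → x ∉ p → ∣ p ∣ < ∣ p ∪ ⁅ x ⁆ ∣
  ∣p∣<∣p∪⁅x⁆∣ {p} {x} x∉p = p⊂q⇒∣p∣<∣q∣ (p⊆p∪q ⁅ x ⁆ , x , x∈p∪q⁺ (inj₂ (x∈⁅x⁆ x)) , x∉p)

  1<∣⁅x⁆∪⁅y⁆∣ : ∀ {x y : Fin n} → x ≢ y → 1 < ∣ ⁅ x ⁆ ∪ ⁅ y ⁆ ∣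
  1<∣⁅x⁆∪⁅y⁆∣ {x} {y} x≢y =
    subst (_< ∣ ⁅ x ⁆ ∪ ⁅ y ⁆ ∣) (∣⁅x⁆∣≡1 x) (∣p∣<∣p∪⁅x⁆∣ (x≢y⇒x∉⁅y⁆ (x≢y ∘ sym)))

  1<∣p∣⇒distinct : ∀ {p : Subset n} → 1 < ∣ p ∣ → ∃[ a ] ∃[ b ] (a ≢ b × a ∈ p × b ∈ p)
  1<∣p∣⇒distinct {p} 1<∣p∣ with nonempty? p
  ... | no ∄a with () ← subst (1 <_) (trans (cong ∣_∣ (Empty-unique ∄a)) (∣⊥∣≡0 n)) 1<∣p∣
  ... | yes (a , a∈p) with any? (λ b → (b ∈? p) ×-dec ¬? (b ≟ a))
  ...   | yes (b , b∈p , b≢a) = a , b , b≢a ∘ sym , a∈p , b∈p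
  ...   | no ∄b = ⊥-elim (<⇒≱ 1<∣p∣ (subst (∣ p ∣ ≤_) (∣⁅x⁆∣≡1 a) (p⊆q⇒∣p∣≤∣q∣ p⊆⁅a⁆)))
    where
    p⊆⁅a⁆ : p ⊆ ⁅ a ⁆
    p⊆⁅a⁆ {x} x∈p = subst (_∈ ⁅ a ⁆) (sym (decidable-stable (x ≟ a) (∄b ∘ (x ,_) ∘ (x∈p ,_)))) (x∈⁅x⁆ a)

module _ {n : ℕ} (i j : Fin n) where

  transpose-matchˡ : PC.transpose i j i ≡ j
  transpose-matchˡ rewrite dec-true (i ≟ i) refl = refl

  transpose-matchʳ : PC.transpose i j j ≡ i
  transpose-matchʳ with j ≟ i
  ... | yes j≡i = j≡i
  ... | no _ rewrite dec-true (j ≟ j) refl = refl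

  transpose-fix : ∀ {k} → k ≢ i → k ≢ j → PC.transpose i j k ≡ k
  transpose-fix {k} k≢i k≢j rewrite dec-false (k ≟ i) k≢i | dec-false (k ≟ j) k≢j = refl

transpose-comm : ∀ {n} (i j k : Fin n) → PC.transpose i j k ≡ PC.transpose j i k
transpose-comm i j k = cases (k ≟ i) (k ≟ j)
  where
  cases : Dec (k ≡ i) → Dec (k ≡ j) → PC.transpose i j k ≡ PC.transpose j i k
  cases (yes refl) _          = trans (transpose-matchˡ k j) (sym (transpose-matchʳ j k))
  cases (no _)     (yes refl) = trans (transpose-matchʳ i k) (sym (transpose-matchˡ k i))
  cases (no k≢i)   (no k≢j)   = trans (transpose-fix i j k≢i k≢j) (sym (transpose-fix j i k≢j k≢i))

transpose-involutive : ∀ {n} (i j k : Fin n) → PC.transpose i j (PC.transpose i j k) ≡ k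
transpose-involutive i j k = trans (cong (PC.transpose i j) (transpose-comm i j k)) (PC.transpose-inverse i j)

transpose-conj : ∀ {n} (ψ : Permutation′ n) (i j k : Fin n) →
                 ψ ⟨$⟩ʳ PC.transpose i j k ≡ PC.transpose (ψ ⟨$⟩ʳ i) (ψ ⟨$⟩ʳ j) (ψ ⟨$⟩ʳ k)
transpose-conj ψ i j k = cases (k ≟ i) (k ≟ j)
  where
  ψ-inj = permutation-injective ψ
  cases : Dec (k ≡ i) → Dec (k ≡ j) →
          ψ ⟨$⟩ʳ PC.transpose i j k ≡ PC.transpose (ψ ⟨$⟩ʳ i) (ψ ⟨$⟩ʳ j) (ψ ⟨$⟩ʳ k)
  cases (yes refl) _          = trans (cong (ψ ⟨$⟩ʳ_) (transpose-matchˡ k j))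
                                  (sym (transpose-matchˡ (ψ ⟨$⟩ʳ k) (ψ ⟨$⟩ʳ j)))
  cases (no _)     (yes refl) = trans (cong (ψ ⟨$⟩ʳ_) (transpose-matchʳ i k))
                                  (sym (transpose-matchʳ (ψ ⟨$⟩ʳ i) (ψ ⟨$⟩ʳ k)))
  cases (no k≢i)   (no k≢j)   = trans (cong (ψ ⟨$⟩ʳ_) (transpose-fix i j k≢i k≢j))
                                  (sym (transpose-fix _ _ (k≢i ∘ ψ-inj) (k≢j ∘ ψ-inj)))

permutation-to-01 : ∀ {m} {i j : Fin (suc (suc m))} → i ≢ j →
                    ∃[ ψ ] (ψ ⟨$⟩ʳ i ≡ 0F × ψ ⟨$⟩ʳ j ≡ 1F)
permutation-to-01 {i = i} {j} i≢j = transpose i 0F ∘ₚ transpose j' 1F , ψi≡0 , transpose-matchˡ j' 1F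
  where
  j' = PC.transpose i 0F j
  j'≢0 : j' ≢ 0F
  j'≢0 j'≡0 = i≢j (sym (permutation-injective (transpose i 0F) (trans j'≡0 (sym (transpose-matchˡ i 0F)))))
  ψi≡0 : PC.transpose j' 1F (PC.transpose i 0F i) ≡ 0F
  ψi≡0 = trans (cong (PC.transpose j' 1F) (transpose-matchˡ i 0F)) (transpose-fix j' 1F (j'≢0 ∘ sym) λ ())

isInv-fixed : ∀ {n} (ψ : Permutation′ n) {a b} → ψ ⟨$⟩ʳ a ≡ a → ψ ⟨$⟩ʳ b ≡ b → isInv ψ a b ≡ 0
isInv-fixed ψ {a} {b} ψa≡a ψb≡b with toℕ a <ᵇ toℕ b in a<b | toℕ (ψ ⟨$⟩ʳ b) <ᵇ toℕ (ψ ⟨$⟩ʳ a) in ψb<ψa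
... | true  | true  = ⊥-elim (<-asym (<ᵇ⇒< _ _ (subst T (sym a<b) _)) b<a)
  where
  b<a : toℕ b < toℕ a
  b<a = subst₂ (λ u v → toℕ u < toℕ v) ψb≡b ψa≡a (<ᵇ⇒< _ _ (subst T (sym ψb<ψa) _))
... | true  | false = refl
... | false | _     = refl

sum-zero : ∀ {xs : List ℕ} → All (_≡ 0) xs → sum xs ≡ 0
sum-zero []          = refl
sum-zero (refl ∷ ps) = sum-zero ps

-- allFin unfolds to 0 ∷ 1 ∷ …, so the inversion (0, 1) is the head of the list of entries
-- (hence the suc); every remaining entry is 0.
inversions-transpose01 : ∀ m → inversions (transpose {suc (suc m)} 0F 1F) ≡ 1
inversions-transpose01 m = cong suc (sum-zero (++⁺ row₀-tail (++⁺ row₁ later-rows)))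
  where
  σ = transpose {suc (suc m)} 0F 1F
  ss : Fin m → Fin (suc (suc m))
  ss k = suc (suc k)
  row : Fin (suc (suc m)) → List ℕ
  row a = map (isInv σ a) (allFin (suc (suc m)))
  row₀-tail : All (_≡ 0) (map (isInv σ 0F) (tabulate ss))
  row₀-tail = map⁺ (tabulate⁺ {f = ss} λ _ → refl)
  row₁ : All (_≡ 0) (row 1F)
  row₁ = refl ∷ refl ∷ map⁺ (tabulate⁺ {f = ss} λ _ → refl)
  later-row : ∀ k b → isInv σ (ss k) b ≡ 0
  later-row k 0F            = refl
  later-row k 1F            = refl
  later-row k (suc (suc l)) = isInv-fixed σ {ss k} {ss l} refl refl
  later-rows : All (_≡ 0) (concatMap row (tabulate ss))
  later-rows = concat⁺ (map⁺ (tabulate⁺ {f = ss} λ k → map⁺ (tabulate⁺ {f = λ b → b} (later-row k))))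

sign-transpose01 : ∀ m → sign (transpose {suc (suc m)} 0F 1F) ≡ s-
sign-transpose01 m = cong parity (inversions-transpose01 m)

module _ {c ℓ} (V : Module ℚ-ring c ℓ) where
  open Module V
  open ≈-Reasoning ≈ᴹ-setoid

  x≈-x⇒x≈0 : ∀ {x} → x ≈ᴹ -ᴹ x → x ≈ᴹ 0ᴹ
  x≈-x⇒x≈0 {x} x≈-x = begin
    x                           ≈⟨ ≈ᴹ-sym (*ₗ-identityˡ x) ⟩
    1ℚ *ₗ x                     ≡⟨⟩
    (½ * (1ℚ +ℚ 1ℚ)) *ₗ x       ≈⟨ *ₗ-assoc ½ (1ℚ +ℚ 1ℚ) x ⟩
    ½ *ₗ ((1ℚ +ℚ 1ℚ) *ₗ x)      ≈⟨ *ₗ-congˡ (*ₗ-distribʳ x 1ℚ 1ℚ) ⟩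
    ½ *ₗ (1ℚ *ₗ x +ᴹ 1ℚ *ₗ x)   ≈⟨ *ₗ-congˡ (+ᴹ-cong (*ₗ-identityˡ x) (*ₗ-identityˡ x)) ⟩
    ½ *ₗ (x +ᴹ x)               ≈⟨ *ₗ-congˡ (+ᴹ-congˡ x≈-x) ⟩
    ½ *ₗ (x +ᴹ -ᴹ x)            ≈⟨ *ₗ-congˡ (-ᴹ‿inverseʳ x) ⟩
    ½ *ₗ 0ᴹ                     ≈⟨ *ₗ-zeroʳ ½ ⟩
    0ᴹ                          ∎

module _ {n : ℕ} (ψ : Permutation′ n) where

  lookup-image : ∀ S x → lookup (image ψ S) x ≡ lookup S (ψ ⟨$⟩ˡ x)
  lookup-image S = lookup∘tabulate (lookup S ∘ (ψ ⟨$⟩ˡ_))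

  ∈-image⁻ : ∀ {S y} → y ∈ image ψ S → ψ ⟨$⟩ˡ y ∈ S
  ∈-image⁻ {S} {y} y∈ψS = lookup⇒[]= _ S (trans (sym (lookup-image S y)) ([]=⇒lookup y∈ψS))

  ∈-image⁺ : ∀ {S x} → x ∈ S → ψ ⟨$⟩ʳ x ∈ image ψ S
  ∈-image⁺ {S} {x} x∈S = lookup⇒[]= _ (image ψ S)
    (trans (lookup-image S _) (trans (cong (lookup S) (inverseˡ ψ)) ([]=⇒lookup x∈S)))

  image-⊆ : ∀ {S T} → (∀ {x} → x ∈ S → ψ ⟨$⟩ʳ x ∈ T) → image ψ S ⊆ T
  image-⊆ {T = T} ψS⊆T y∈ψS = subst (_∈ T) (inverseʳ ψ) (ψS⊆T (∈-image⁻ y∈ψS))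

  image-mono : ∀ {S T} → S ⊆ T → image ψ S ⊆ image ψ T
  image-mono S⊆T = image-⊆ (∈-image⁺ ∘ S⊆T)

  ∣image∣ : ∀ S → ∣ image ψ S ∣ ≡ ∣ S ∣
  ∣image∣ S = begin
    ∣ image ψ S ∣                         ≡⟨ ∣tabulate∣ (lookup S ∘ (ψ ⟨$⟩ˡ_)) ⟩
    ∑ (indicator ∘ lookup S ∘ (ψ ⟨$⟩ˡ_))  ≡⟨ sum-permute (indicator ∘ lookup S) (flip ψ) ⟨
    ∑ (indicator ∘ lookup S)              ≡⟨ ∣tabulate∣ (lookup S) ⟨
    ∣ tabulateᵛ (lookup S) ∣              ≡⟨ cong ∣_∣ (tabulate∘lookup S) ⟩
    ∣ S ∣                                 ∎
    where
    open ≡-Reasoning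
    indicator : Bool → ℕ
    indicator b = if b then 1 else 0
    ∣tabulate∣ : ∀ {m} (g : Fin m → Bool) → ∣ tabulateᵛ g ∣ ≡ ∑ (indicator ∘ g)
    ∣tabulate∣ {zero}  g = refl
    ∣tabulate∣ {suc m} g with g 0F
    ... | true  = cong suc (∣tabulate∣ (g ∘ suc))
    ... | false = ∣tabulate∣ (g ∘ suc)

image-id : ∀ {n} (S : Subset n) → image id S ≡ S
image-id = tabulate∘lookup

image-image : ∀ {n} (ψ φ : Permutation′ n) S → image φ (image ψ S) ≡ image (ψ ∘ₚ φ) S
image-image ψ φ S = tabulate-cong (λ x → lookup-image ψ S (φ ⟨$⟩ˡ x))

image-cong : ∀ {n} (ψ φ : Permutation′ n) → ψ ≈ φ → ∀ S → image ψ S ≡ image φ S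
image-cong ψ φ ψ≈φ S = tabulate-cong (λ x → cong (lookup S) (ψˡ≗φˡ x))
  where
  open ≡-Reasoning
  ψˡ≗φˡ : ∀ x → ψ ⟨$⟩ˡ x ≡ φ ⟨$⟩ˡ x
  ψˡ≗φˡ x = begin
    ψ ⟨$⟩ˡ x                       ≡⟨ cong (ψ ⟨$⟩ˡ_) (inverseʳ φ) ⟨
    ψ ⟨$⟩ˡ (φ ⟨$⟩ʳ (φ ⟨$⟩ˡ x))     ≡⟨ cong (ψ ⟨$⟩ˡ_) (ψ≈φ (φ ⟨$⟩ˡ x)) ⟨
    ψ ⟨$⟩ˡ (ψ ⟨$⟩ʳ (φ ⟨$⟩ˡ x))     ≡⟨ inverseˡ ψ ⟩
    φ ⟨$⟩ˡ x                       ∎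

image-flip-image : ∀ {n} (ψ : Permutation′ n) S → image (flip ψ) (image ψ S) ≡ S
image-flip-image ψ S = begin
  image (flip ψ) (image ψ S)  ≡⟨ image-image ψ (flip ψ) S ⟩
  image (ψ ∘ₚ flip ψ) S       ≡⟨ image-cong (ψ ∘ₚ flip ψ) id (λ _ → inverseˡ ψ) S ⟩
  image id S                  ≡⟨ image-id S ⟩
  S                           ∎
  where open ≡-Reasoning

image-transpose-involutive : ∀ {n} (i j : Fin n) S →
                             image (transpose i j) (image (transpose i j) S) ≡ S
image-transpose-involutive i j S = begin
  image τ (image τ S)  ≡⟨ image-image τ τ S ⟩
  image (τ ∘ₚ τ) S     ≡⟨ image-cong (τ ∘ₚ τ) id (transpose-involutive i j) S ⟩
  image id S           ≡⟨ image-id S ⟩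
  S                    ∎
  where
  open ≡-Reasoning
  τ = transpose i j

image-transpose-⊆ : ∀ {n} {i j : Fin n} {S} → (i ∈ S → j ∈ S) → (j ∈ S → i ∈ S) →
                    image (transpose i j) S ⊆ S
image-transpose-⊆ {i = i} {j} {S} i∈⇒j∈ j∈⇒i∈ =
  image-⊆ (transpose i j) (λ {x} x∈S → cases x∈S (x ≟ i) (x ≟ j))
  where
  cases : ∀ {x} → x ∈ S → Dec (x ≡ i) → Dec (x ≡ j) → PC.transpose i j x ∈ S
  cases x∈S (yes refl) _          = subst (_∈ S) (sym (transpose-matchˡ i j)) (i∈⇒j∈ x∈S)
  cases x∈S (no _)     (yes refl) = subst (_∈ S) (sym (transpose-matchʳ i j)) (j∈⇒i∈ x∈S)
  cases x∈S (no x≢i)   (no x≢j)   = subst (_∈ S) (sym (transpose-fix i j x≢i x≢j)) x∈S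

T-injective : ∀ {a b} → (T a → T b) → (T b → T a) → a ≡ b
T-injective {false} {false} _   _   = refl
T-injective {false} {true}  _   b⇒a = ⊥-elim (b⇒a _)
T-injective {true}  {false} a⇒b _   = ⊥-elim (a⇒b _)
T-injective {true}  {true}  _   _   = refl

module _ {n : ℕ} where

  IsIso-∘ : ∀ {ind₁ ind₂ ind₃ : Subset n → Bool} {ψ φ} →
            IsIso ind₁ ind₂ ψ → IsIso ind₂ ind₃ φ → IsIso ind₁ ind₃ (ψ ∘ₚ φ)
  IsIso-∘ {ind₁} {ind₂} {ind₃} {ψ} {φ} ψ-iso φ-iso S = begin
    ind₃ (image (ψ ∘ₚ φ) S)     ≡⟨ cong ind₃ (image-image ψ φ S) ⟨
    ind₃ (image φ (image ψ S))  ≡⟨ φ-iso (image ψ S) ⟩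
    ind₂ (image ψ S)            ≡⟨ ψ-iso S ⟩
    ind₁ S                      ∎
    where open ≡-Reasoning

  IsIso-cong : ∀ {ind ind' : Subset n → Bool} ψ φ → ψ ≈ φ → IsIso ind ind' ψ → IsIso ind ind' φ
  IsIso-cong {ind' = ind'} ψ φ ψ≈φ ψ-iso S = trans (cong ind' (sym (image-cong ψ φ ψ≈φ S))) (ψ-iso S)

  involution-preserving-indep⇒automorphism :
    ∀ {ind : Subset n → Bool} {σ} → (∀ S → image σ (image σ S) ≡ S) →
    (∀ S → Indep ind S → Indep ind (image σ S)) → IsIso ind ind σ
  involution-preserving-indep⇒automorphism {ind} {σ} σ²≡id preserves S =
    T-injective (subst (Indep ind) (σ²≡id S) ∘ preserves (image σ S)) (preserves S)

  relabel : Permutation′ n → (Subset n → Bool) → Subset n → Bool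
  relabel ψ ind S = ind (image (flip ψ) S)

  relabel-IsIso : ∀ {ind} (ψ : Permutation′ n) → IsIso ind (relabel ψ ind) ψ
  relabel-IsIso {ind} ψ S = cong ind (image-flip-image ψ S)

  relabel-automorphism : ∀ {ind} (ψ : Permutation′ n) {σ} → IsIso ind ind σ →
                         IsIso (relabel ψ ind) (relabel ψ ind) (flip ψ ∘ₚ σ ∘ₚ ψ)
  relabel-automorphism {ind} ψ {σ} σ-aut =
    IsIso-∘ {relabel ψ ind} {ind} {relabel ψ ind} {flip ψ} {σ ∘ₚ ψ} (λ _ → refl)
      (IsIso-∘ {ind} {ind} {relabel ψ ind} {σ} {ψ} σ-aut (relabel-IsIso ψ))

  relabel-IsMatroid : ∀ {ind} (ψ : Permutation′ n) → IsMatroid n ind → IsMatroid n (relabel ψ ind)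
  relabel-IsMatroid {ind} ψ M = record
    { empty-indep = hereditary (image-⊆ φ (⊥-elim ∘ ∉⊥)) empty-indep
    ; hereditary  = hereditary ∘ image-mono φ
    ; augment     = augment'
    }
    where
    open IsMatroid M
    φ = flip ψ
    augment' : ∀ {I J} → Indep ind (image φ I) → Indep ind (image φ J) → ∣ I ∣ < ∣ J ∣ →
               ∃[ x ] (x ∈ J × x ∉ I × Indep ind (image φ (I ∪ ⁅ x ⁆)))
    augment' {I} {J} φI-indep φJ-indep ∣I∣<∣J∣
      with augment φI-indep φJ-indep (subst₂ _<_ (sym (∣image∣ φ I)) (sym (∣image∣ φ J)) ∣I∣<∣J∣)
    ... | y , y∈φJ , y∉φI , φI+y-indep =
      ψ ⟨$⟩ʳ y , ∈-image⁻ φ y∈φJ , y∉φI ∘ subst (_∈ image φ I) (inverseˡ ψ) ∘ ∈-image⁺ φ ,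
      hereditary (image-⊆ φ φ[I+x]⊆φI+y) φI+y-indep
      where
      φ[I+x]⊆φI+y : ∀ {z} → z ∈ I ∪ ⁅ ψ ⟨$⟩ʳ y ⁆ → φ ⟨$⟩ʳ z ∈ image φ I ∪ ⁅ y ⁆
      φ[I+x]⊆φI+y {z} z∈I+x with x∈p∪q⁻ I _ z∈I+x
      ... | inj₁ z∈I = x∈p∪q⁺ (inj₁ (∈-image⁺ φ z∈I))
      ... | inj₂ z∈x rewrite x∈⁅y⁆⇒x≡y _ z∈x =
        x∈p∪q⁺ (inj₂ (subst (_∈ ⁅ y ⁆) (sym (inverseˡ ψ)) (x∈⁅x⁆ y)))

module _ {n : ℕ} {ind : Subset n → Bool} (M : IsMatroid n ind) where

  odd-automorphism⇒vanishes : ∀ {σ} → IsIso ind ind σ → sign σ ≡ s- → ∀ η → ClassVanishes n ind η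
  odd-automorphism⇒vanishes {σ} σ-aut σ-odd η V f R = x≈-x⇒x≈0 V (begin
    f n ind η              ≈⟨ iso-rel n ind ind M M σ σ-aut η ⟩
    f n ind (push σ η)     ≡⟨ cong (λ s → f n ind (s *ˢ η)) σ-odd ⟩
    f n ind (negate {n} η) ≈⟨ sign-rel n ind M η ⟩
    -ᴹ f n ind η           ∎)
    where
    open Module V
    open Respects R
    open ≈-Reasoning ≈ᴹ-setoid

  iso⇒vanishes : ∀ {ind' ψ} → IsMatroid n ind' → IsIso ind ind' ψ →
                 (∀ η' → ClassVanishes n ind' η') → ∀ η → ClassVanishes n ind η
  iso⇒vanishes {ind'} {ψ} M' ψ-iso vanishes' η V f R =
    Module.≈ᴹ-trans V (Respects.iso-rel R n ind ind' M M' ψ ψ-iso η) (vanishes' (push ψ η) V f R)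

-- Signs are computed only for (0 1): relabelling i, j as 0, 1 conjugates (i j) to (0 1).
transposition-automorphism⇒vanishes :
  ∀ {n} {ind : Subset n → Bool} → IsMatroid n ind →
  ∀ {i j} → i ≢ j → IsIso ind ind (transpose i j) → ∀ η → ClassVanishes n ind η
transposition-automorphism⇒vanishes {suc zero} _ {0F} {0F} i≢j _ with () ← i≢j refl
transposition-automorphism⇒vanishes {suc (suc m)} {ind} M {i} {j} i≢j τ-aut with permutation-to-01 i≢j
... | ψ , ψi≡0 , ψj≡1 =
  iso⇒vanishes M {ψ = ψ} M' (relabel-IsIso ψ)
    (odd-automorphism⇒vanishes M' {σ = transpose 0F 1F} swap-aut (sign-transpose01 m))
  where
  M' = relabel-IsMatroid ψ M
  open ≡-Reasoning
  conj : flip ψ ∘ₚ transpose i j ∘ₚ ψ ≈ transpose 0F 1F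
  conj x = begin
    ψ ⟨$⟩ʳ PC.transpose i j (ψ ⟨$⟩ˡ x)                         ≡⟨ transpose-conj ψ i j (ψ ⟨$⟩ˡ x) ⟩
    PC.transpose (ψ ⟨$⟩ʳ i) (ψ ⟨$⟩ʳ j) (ψ ⟨$⟩ʳ (ψ ⟨$⟩ˡ x))  ≡⟨ cong₂ (λ a b → PC.transpose a b (ψ ⟨$⟩ʳ (ψ ⟨$⟩ˡ x)))
                                                                    ψi≡0 ψj≡1 ⟩
    PC.transpose 0F 1F (ψ ⟨$⟩ʳ (ψ ⟨$⟩ˡ x))                   ≡⟨ cong (PC.transpose 0F 1F) (inverseʳ ψ) ⟩
    PC.transpose 0F 1F x                                     ∎
  swap-aut : IsIso (relabel ψ ind) (relabel ψ ind) (transpose 0F 1F)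
  swap-aut = IsIso-cong {ind = relabel ψ ind} {relabel ψ ind} (flip ψ ∘ₚ transpose i j ∘ₚ ψ)
    (transpose 0F 1F) conj (relabel-automorphism ψ {transpose i j} τ-aut)

module ParallelElements {n} {ind : Subset n → Bool} (M : IsMatroid n ind) where
  open IsMatroid M

  Parallel : Fin n → Fin n → Set
  Parallel x y = x ≢ y × Indep ind ⁅ x ⁆ × Indep ind ⁅ y ⁆ × ¬ Indep ind (⁅ x ⁆ ∪ ⁅ y ⁆)

  parallel? : Dec (∃[ x ] ∃[ y ] Parallel x y)
  parallel? = any? λ x → any? λ y →
    ¬? (x ≟ y) ×-dec T? (ind ⁅ x ⁆) ×-dec T? (ind ⁅ y ⁆) ×-dec ¬? (T? (ind (⁅ x ⁆ ∪ ⁅ y ⁆)))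

  parallel-sym : ∀ {x y} → Parallel x y → Parallel y x
  parallel-sym {x} {y} (x≢y , x-indep , y-indep , xy-dep) =
    x≢y ∘ sym , y-indep , x-indep , xy-dep ∘ subst (Indep ind) (∪-comm ⁅ y ⁆ ⁅ x ⁆)

  Replaces : Fin n → Fin n → Set
  Replaces i j = Indep ind ⁅ j ⁆ ×
                 (∀ s → s ≢ i → s ≢ j → Indep ind (⁅ i ⁆ ∪ ⁅ s ⁆) → Indep ind (⁅ j ⁆ ∪ ⁅ s ⁆))

  -- Augmenting {y} from {x, s} cannot add x, so it adds s.
  parallel⇒replaces : ∀ {x y} → Parallel x y → Replaces x y
  parallel⇒replaces {x} {y} (_ , _ , y-indep , xy-dep) = y-indep , replace
    where
    replace : ∀ s → s ≢ x → s ≢ y → Indep ind (⁅ x ⁆ ∪ ⁅ s ⁆) → Indep ind (⁅ y ⁆ ∪ ⁅ s ⁆)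
    replace s s≢x _ xs-indep
      with augment y-indep xs-indep
             (subst (_< ∣ ⁅ x ⁆ ∪ ⁅ s ⁆ ∣) (sym (∣⁅x⁆∣≡1 y)) (1<∣⁅x⁆∪⁅y⁆∣ (s≢x ∘ sym)))
    ... | z , z∈xs , _ , yz-indep with ∈-pair⁻ z∈xs
    ...   | inj₁ refl = ⊥-elim (xy-dep (subst (Indep ind) (∪-comm ⁅ y ⁆ ⁅ z ⁆) yz-indep))
    ...   | inj₂ refl = yz-indep

  parallel-free⇒replaces : ∀ {i j} → ¬ (∃[ x ] ∃[ y ] Parallel x y) → Indep ind ⁅ j ⁆ → Replaces i j
  parallel-free⇒replaces {i} {j} ∄parallel j-indep = j-indep , replace
    where
    replace : ∀ s → s ≢ i → s ≢ j → Indep ind (⁅ i ⁆ ∪ ⁅ s ⁆) → Indep ind (⁅ j ⁆ ∪ ⁅ s ⁆)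
    replace s _ s≢j is-indep = decidable-stable (T? _) λ js-dep →
      ∄parallel (j , s , s≢j ∘ sym , j-indep , hereditary (q⊆p∪q ⁅ i ⁆ ⁅ s ⁆) is-indep , js-dep)

module RankAtMostTwo {n} {ind : Subset n → Bool} (M : IsMatroid n ind)
                     (rank≤2 : ∀ S → Indep ind S → ∣ S ∣ ≤ 2) where
  open IsMatroid M
  open ParallelElements M

  indep-⊆-pair : ∀ {S i s} → Indep ind S → i ∈ S → s ∈ S → i ≢ s → S ⊆ ⁅ i ⁆ ∪ ⁅ s ⁆
  indep-⊆-pair {S} {i} {s} S-indep i∈S s∈S i≢s {u} u∈S with u ∈? (⁅ i ⁆ ∪ ⁅ s ⁆)
  ... | yes u∈is = u∈is
  ... | no u∉is = ⊥-elim (<⇒≱ 2<∣S∣ (rank≤2 S S-indep))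
    where
    open ≤-Reasoning
    2<∣S∣ : 2 < ∣ S ∣
    2<∣S∣ = begin-strict
      2                              ≤⟨ 1<∣⁅x⁆∪⁅y⁆∣ i≢s ⟩
      ∣ ⁅ i ⁆ ∪ ⁅ s ⁆ ∣              <⟨ ∣p∣<∣p∪⁅x⁆∣ u∉is ⟩
      ∣ (⁅ i ⁆ ∪ ⁅ s ⁆) ∪ ⁅ u ⁆ ∣    ≤⟨ p⊆q⇒∣p∣≤∣q∣ (∪-lub (∪-lub (x∈p⇒⁅x⁆⊆p i∈S) (x∈p⇒⁅x⁆⊆p s∈S))
                                                          (x∈p⇒⁅x⁆⊆p u∈S)) ⟩
      ∣ S ∣                          ∎

  -- Such an S is {i} or {i, s} by indep-⊆-pair, and (i j) maps it into {j} or {j, s}.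
  replaces⇒indep-image : ∀ {i j S} → Replaces i j → Indep ind S → i ∈ S → j ∉ S →
                         Indep ind (image (transpose i j) S)
  replaces⇒indep-image {i} {j} {S} (j-indep , replace) S-indep i∈S j∉S
    with any? (λ s → (s ∈? S) ×-dec ¬? (s ≟ i))
  ... | yes (s , s∈S , s≢i) =
    hereditary (image-⊆ (transpose i j) (τ-maps ∘ ∈-pair⁻ ∘ indep-⊆-pair S-indep i∈S s∈S (s≢i ∘ sym)))
      (replace s s≢i s≢j (hereditary (∪-lub (x∈p⇒⁅x⁆⊆p i∈S) (x∈p⇒⁅x⁆⊆p s∈S)) S-indep))
    where
    s≢j : s ≢ j
    s≢j refl = j∉S s∈S
    τ-maps : ∀ {x} → x ≡ i ⊎ x ≡ s → PC.transpose i j x ∈ ⁅ j ⁆ ∪ ⁅ s ⁆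
    τ-maps (inj₁ refl) = ∈-pair⁺ (inj₁ (transpose-matchˡ i j))
    τ-maps (inj₂ refl) = ∈-pair⁺ (inj₂ (transpose-fix i j s≢i s≢j))
  ... | no ∄s = hereditary (image-⊆ (transpose i j) τ-maps) j-indep
    where
    τ-maps : ∀ {x} → x ∈ S → PC.transpose i j x ∈ ⁅ j ⁆
    τ-maps {x} x∈S with decidable-stable (x ≟ i) (∄s ∘ (x ,_) ∘ (x∈S ,_))
    ... | refl = subst (_∈ ⁅ j ⁆) (sym (transpose-matchˡ i j)) (x∈⁅x⁆ j)

  replaces⇒automorphism : ∀ {i j} → Replaces i j → Replaces j i → IsIso ind ind (transpose i j)
  replaces⇒automorphism {i} {j} i→j j→i =
    involution-preserving-indep⇒automorphism {σ = transpose i j}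
      (image-transpose-involutive i j) preserves
    where
    preserves : ∀ S → Indep ind S → Indep ind (image (transpose i j) S)
    preserves S S-indep with i ∈? S | j ∈? S
    ... | yes i∈S | no j∉S  = replaces⇒indep-image i→j S-indep i∈S j∉S
    ... | no i∉S  | yes j∈S =
      subst (Indep ind) (image-cong (transpose j i) (transpose i j) (transpose-comm j i) S)
        (replaces⇒indep-image j→i S-indep j∈S i∉S)
    ... | yes i∈S | yes j∈S = hereditary (image-transpose-⊆ (λ _ → j∈S) (λ _ → i∈S)) S-indep
    ... | no i∉S  | no j∉S  = hereditary (image-transpose-⊆ (⊥-elim ∘ i∉S) (⊥-elim ∘ j∉S)) S-indep

  transposable-pair : ∃[ B ] (Indep ind B × ∣ B ∣ ≡ 2) →
                      ∃[ i ] ∃[ j ] (i ≢ j × IsIso ind ind (transpose i j))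
  transposable-pair (B , B-indep , ∣B∣≡2) with parallel?
  ... | yes (x , y , x∥y) =
    x , y , proj₁ x∥y ,
    replaces⇒automorphism (parallel⇒replaces x∥y) (parallel⇒replaces (parallel-sym x∥y))
  ... | no ∄parallel with 1<∣p∣⇒distinct (subst (1 <_) (sym ∣B∣≡2) ≤-refl)
  ...   | a , b , a≢b , a∈B , b∈B =
    a , b , a≢b ,
    replaces⇒automorphism (parallel-free⇒replaces ∄parallel (non-loop b∈B))
                          (parallel-free⇒replaces ∄parallel (non-loop a∈B))
    where
    non-loop : ∀ {x} → x ∈ B → Indep ind ⁅ x ⁆
    non-loop x∈B = hereditary (x∈p⇒⁅x⁆⊆p x∈B) B-indep

corollary6p4 : (n : ℕ) (ind : Subset n → Bool) → IsMatroid n ind → HasRank ind 2 →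
    (η : Orientation n) → ClassVanishes n ind η
corollary6p4 n ind M (basis , rank≤2) with RankAtMostTwo.transposable-pair M rank≤2 basis
... | i , j , i≢j , τ-aut = transposition-automorphism⇒vanishes M i≢j τ-aut
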